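{- Let $w$ be a string of length $n$, let $\tau$ be an integer with $1 \le \tau \le n/4$ such that $n$ is a multiple of $2\tau$, and for $k \in [1..n/\tau]$ let $B_k = [(k-1)\tau .. k\tau - 1]$. Let $L_k$ be the set of maximal even-palindromes of $w$ of length greater than $2\tau$ whose centers lie in $B_k$. If $|L_k| \ge 3$, then the sequence of lengths of the maximal palindromes in $L_k$, sorted by their center positions, can be represented by at most two arithmetic progressions and at most one integer (i.e., it is a concatenation of an arithmetic progression, at most one single integer, and an arithmetic progression, some of which may be empty). Also, the center positions of the elements of $L_k$ form a single arithmetic progression.
   Context: Strings are 0-indexed: $w = w[0]\cdots w[n-1]$. An even-palindrome is a string of even length equal to its reversal. An even-palindromic factor $w[c-r..c+r-1]$ is centered at $c$; it is the maximal even-palindrome centered at $c$ if $c-r=0$, or $c+r-1=n-1$, or $w[c-r-1]\ne w[c+r]$. Each position $c\in[0,n)$ is the center of exactly one maximal even-palindrome. -}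

module Defs where

open import Data.Nat using (ℕ; suc; _+_; _*_; _∸_; _≤_; _<_)
open import Data.Integer using (ℤ; +_) renaming (_+_ to _+ℤ_)
open import Data.List using (List)
open import Data.List.Relation.Unary.Linked using (Linked)
open import Data.Product using (Σ; _×_)
open import Data.Sum using (_⊎_)
open import Relation.Binary.PropositionalEquality using (_≡_; _≢_)
open import Relation.Nullary using (¬_)

-- A string w of length n over alphabet A is given as w : ℕ → A together
-- with n; only the characters w 0 , … , w (n - 1) are ever inspected.

-- w[c-r .. c+r-1] is an even palindrome (centered at c, radius r, length 2r):
-- it lies inside [0, n) and w[c-1-j] = w[c+j] for all j < r.
IsEvenPal : {A : Set} → (n : ℕ) → (ℕ → A) → (c r : ℕ) → Set
IsEvenPal n w c r =
  r ≤ c × c + r ≤ n × (∀ j → j < r → w (c ∸ suc j) ≡ w (c + j))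

IsMaxEvenPal : {A : Set} → (n : ℕ) → (ℕ → A) → (c r : ℕ) → Set
IsMaxEvenPal n w c r =
  IsEvenPal n w c r × (c ≡ r ⊎ c + r ≡ n ⊎ w (c ∸ suc r) ≢ w (c + r))

InBlock : (τ k c : ℕ) → Set
InBlock τ k c = (k ∸ 1) * τ ≤ c × c < k * τ

IsAP : List ℕ → Set
IsAP xs = Σ ℤ (λ d → Linked (λ x y → + y ≡ (+ x) +ℤ d) xs)

-- Two even palindromes of radius R centred at c and c + d make w periodic with period 2d
-- around them: reflecting through c and then through c + d translates by 2d. If three
-- consecutive members of L_k had unequal gaps, the period of the shorter gap would spread over
-- the window of the longer one (a Fine–Wilf-type extension) and translate a palindrome by the
-- shorter gap, giving a palindrome of radius > τ centred in B_k strictly between two consecutive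
-- centres of L_k. So the centres are D apart for a fixed D < τ. For maximal palindromes at
-- x, x + D, x + 2D with radii a, b, c, reflecting through x + D shows that b < a + D forces
-- c = b - D and a + D < b forces c ≤ a. Hence the radii increase by D, take at most one
-- exceptional value, and then decrease by D.

module Submission where

open import Defs
open import Data.Nat using (ℕ; zero; suc; _+_; _*_; _∸_; _≤_; _<_; _≟_; _≤?_; _<?_; z≤n; s≤s; s≤s⁻¹; z<s)
open import Data.Nat.Properties
open import Data.Nat.Divisibility using (_∣_)
open import Data.Nat.Induction using (<-rec)
open import Data.Nat.Tactic.RingSolver using (solve)
open import Algebra.Properties.CommutativeSemigroup +-commutativeSemigroup
  using () renaming (xy∙z≈xz∙y to +-swapʳ)
import Data.Integer as ℤ
import Data.Integer.Properties as ℤ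
import Data.Integer.Tactic.RingSolver as ℤ-Solver
open import Data.List using (List; []; _∷_; map; length; _++_)
open import Data.List.Properties using (map-++; map-∘; length-map)
open import Data.List.Membership.Propositional using (_∈_)
open import Data.List.Relation.Unary.Any using (here; there)
open import Data.List.Relation.Unary.All using (All; tabulate)
open import Data.List.Relation.Unary.Linked using (Linked)
import Data.List.Relation.Unary.Linked as Linked
open import Data.List.Relation.Unary.Linked.Properties using (map⁺)
open import Data.Product using (Σ; ∃-syntax; _×_; _,_; proj₁; proj₂)
open import Data.Sum using (_⊎_; inj₁; inj₂)
open import Data.Unit using (⊤; tt)
open import Data.Empty using (⊥)
open import Function using (_∘_)
open import Relation.Nullary using (¬_; yes; no)
open import Relation.Binary.Definitions using (tri<; tri≈; tri>)
open import Relation.Binary.PropositionalEquality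

-- The ring solver proves E₁ + T ≡ E₂ + S; cancelling S ≡ T then gives E₁ ≡ E₂.
≡-by-cancel : ∀ {E₁ E₂ S T} → S ≡ T → E₁ + T ≡ E₂ + S → E₁ ≡ E₂
≡-by-cancel {E₁} {E₂} {S} {T} S≡T eq = +-cancelʳ-≡ T E₁ E₂ (trans eq (cong (E₂ +_) S≡T))

m+k≡n⇒m≤n : ∀ {m n} k → m + k ≡ n → m ≤ n
m+k≡n⇒m≤n {m} k refl = m≤m+n m k

<⇒positive-offset : ∀ {m n} → m < n → ∃[ k ] 1 ≤ k × m + k ≡ n
<⇒positive-offset {m} m<n with m≤n⇒∃[o]m+o≡n m<n
... | k , eq = suc k , s≤s z≤n , trans (+-suc m k) eq

mirror-offset : ∀ {a j c} → suc (a + (c + j)) ≡ c + c → suc (a + j) ≡ c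
mirror-offset {a} {j} {c} eq = ≡-by-cancel eq (solve (a ∷ j ∷ c ∷ []))

∸-mirror : ∀ {a j c} → suc (a + j) ≡ c → c ∸ suc j ≡ a
∸-mirror {a} {j} refl = m+n∸n≡m a j

module Palindromes {A : Set} (n : ℕ) (w : ℕ → A) where

  Pal : ℕ → ℕ → Set
  Pal = IsEvenPal n w

  MaxPal : ℕ → ℕ → Set
  MaxPal = IsMaxEvenPal n w

  -- Positions a and b are mirror images through the centre c (between positions c - 1 and c)
  -- iff suc (a + b) ≡ c + c; stating mirror pairs this way avoids truncated subtraction.
  pal-at : ∀ {c r a j} → Pal c r → suc (a + j) ≡ c → j < r → w a ≡ w (c + j)
  pal-at {c} {j = j} (_ , _ , symmetric) eq j<r =
    subst (λ i → w i ≡ w (c + j)) (∸-mirror eq) (symmetric j j<r)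

  pal-from-mirror : ∀ {c r} → r ≤ c → c + r ≤ n →
    (∀ {a j} → suc (a + j) ≡ c → j < r → w a ≡ w (c + j)) → Pal c r
  pal-from-mirror {c} r≤c c+r≤n mirror =
    r≤c , c+r≤n , λ j j<r → mirror (trans (sym (+-suc _ j)) (m∸n+n≡m (≤-trans j<r r≤c))) j<r

  pal-mirror-right : ∀ {c r a b} → Pal c r → suc (a + b) ≡ c + c → b < c + r → c ≤ b → w a ≡ w b
  pal-mirror-right {c} {r} {a} p eq b< c≤b with m≤n⇒∃[o]m+o≡n c≤b
  ... | j , refl = pal-at p (mirror-offset {a} {j} eq) (+-cancelˡ-< c j r b<)

  pal-mirror : ∀ {c r a b} → Pal c r → suc (a + b) ≡ c + c → a < c + r → b < c + r → w a ≡ w b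
  pal-mirror {c} {r} {a} {b} p eq a< b< with c ≤? b
  ... | yes c≤b = pal-mirror-right p eq b< c≤b
  ... | no c≰b = sym (pal-mirror-right p (trans (cong suc (+-comm b a)) eq) a< c≤a)
    where
    c≤a : c ≤ a
    c≤a = ≮⇒≥ λ a<c → <-irrefl eq (subst (_≤ c + c) (+-suc (suc a) b) (+-mono-≤ a<c (≰⇒> c≰b)))

  pal-weaken : ∀ {c r ρ} → Pal c r → ρ ≤ r → Pal c ρ
  pal-weaken {c} (r≤c , c+r≤n , symmetric) ρ≤r =
    ≤-trans ρ≤r r≤c , ≤-trans (+-monoʳ-≤ c ρ≤r) c+r≤n , λ j j<ρ → symmetric j (<-≤-trans j<ρ ρ≤r)

  pal-extend : ∀ {c r} → Pal c r → suc r ≤ c → c + suc r ≤ n → w (c ∸ suc r) ≡ w (c + r) → Pal c (suc r)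
  pal-extend {c} {r} (_ , _ , symmetric) r<c c+r<n edge = r<c , c+r<n , symmetric′
    where
    symmetric′ : ∀ j → j < suc r → w (c ∸ suc j) ≡ w (c + j)
    symmetric′ j j≤r with j ≟ r
    ... | yes refl = edge
    ... | no j≢r = symmetric j (≤∧≢⇒< (s≤s⁻¹ j≤r) j≢r)

  maxPal-maximal : ∀ {c r ρ} → MaxPal c r → Pal c ρ → ρ ≤ r
  maxPal-maximal {c} {r} {ρ} (_ , stops) (ρ≤c , c+ρ≤n , symmetric) = ≮⇒≥ (blocked stops)
    where
    blocked : c ≡ r ⊎ c + r ≡ n ⊎ w (c ∸ suc r) ≢ w (c + r) → ¬ r < ρ
    blocked (inj₁ refl) r<ρ = <⇒≱ r<ρ ρ≤c
    blocked (inj₂ (inj₁ refl)) r<ρ = <⇒≱ r<ρ (+-cancelˡ-≤ c ρ r c+ρ≤n)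
    blocked (inj₂ (inj₂ w≢w)) r<ρ = w≢w (symmetric r r<ρ)

  maxPal-edge : ∀ {c r a} → MaxPal c r → suc (a + (c + r)) ≡ c + c → c + r < n → w a ≢ w (c + r)
  maxPal-edge {c} {a = a} (_ , inj₁ refl) eq _ _ = <-irrefl (sym eq) (s≤s (m≤n+m (c + c) a))
  maxPal-edge (_ , inj₂ (inj₁ refl)) _ c+r<n _ = <-irrefl refl c+r<n
  maxPal-edge {c} {r} {a} (_ , inj₂ (inj₂ w≢w)) eq _ =
    w≢w ∘ subst (λ i → w i ≡ w (c + r)) (sym (∸-mirror (mirror-offset {a} {r} eq)))

  -- A is not assumed to have decidable equality, so the maximal radius cannot be computed;
  -- its existence is only shown to be irrefutable, which suffices for refutations.
  pal-¬¬max : ∀ {c ρ} → Pal c ρ → ¬ ¬ (∃[ r ] ρ ≤ r × MaxPal c r)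
  pal-¬¬max {c} {ρ} p = grow (c ∸ ρ) (sym (m+[n∸m]≡n (proj₁ p))) p
    where
    grow : ∀ k {ρ} → c ≡ ρ + k → Pal c ρ → ¬ ¬ (∃[ r ] ρ ≤ r × MaxPal c r)
    grow zero {ρ} c≡ρ+0 p none = none (ρ , ≤-refl , p , inj₁ (trans c≡ρ+0 (+-identityʳ ρ)))
    grow (suc k) {ρ} c≡ρ+k p none with c + ρ ≟ n
    ... | yes at-end = none (ρ , ≤-refl , p , inj₂ (inj₁ at-end))
    ... | no c+ρ≢n = none (ρ , ≤-refl , p , inj₂ (inj₂ λ edge →
          grow k c≡ρ+1+k (pal-extend p ρ<c c+ρ<n edge) λ (r , ρ<r , max) → none (r , <⇒≤ ρ<r , max)))
      where
      c≡ρ+1+k : c ≡ suc ρ + k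
      c≡ρ+1+k = trans c≡ρ+k (+-suc ρ k)
      ρ<c : suc ρ ≤ c
      ρ<c = m+k≡n⇒m≤n k (sym c≡ρ+1+k)
      c+ρ<n : c + suc ρ ≤ n
      c+ρ<n = subst (_≤ n) (sym (+-suc c ρ)) (≤∧≢⇒< (proj₁ (proj₂ p)) c+ρ≢n)

  pal-reflect : ∀ {x δ R r} → Pal (x + δ) R → Pal x r → δ + r ≤ R → Pal (x + δ + δ) r
  pal-reflect {x} {δ} {R} {r} q p δ+r≤R = pal-from-mirror r≤x+δ+δ x+δ+δ+r≤n mirror
    where
    δ≤R : δ ≤ R
    δ≤R = m+n≤o⇒m≤o δ δ+r≤R
    r≤R : r ≤ R
    r≤R = m+n≤o⇒n≤o δ δ+r≤R
    r≤x+δ+δ : r ≤ x + δ + δ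
    r≤x+δ+δ = ≤-trans (proj₁ p) (≤-trans (m≤m+n x δ) (m≤m+n (x + δ) δ))
    x+δ+δ+r≤n : x + δ + δ + r ≤ n
    x+δ+δ+r≤n = subst (_≤ n) (sym (+-assoc (x + δ) δ r)) (≤-trans (+-monoʳ-≤ (x + δ) δ+r≤R) (proj₁ (proj₂ q)))
    mirror : ∀ {a j} → suc (a + j) ≡ x + δ + δ → j < r → w a ≡ w (x + δ + δ + j)
    mirror {a} {j} eq j<r with m≤n⇒∃[o]m+o≡n (≤-trans j<r (proj₁ p))
    ... | u , refl = begin
      w a                 ≡⟨ pal-mirror q (≡-by-cancel eq (solve (a ∷ j ∷ u ∷ δ ∷ []))) a<end x+j<end ⟩
      w (x + j)           ≡⟨ pal-at p (cong suc (+-comm u j)) j<r ⟨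
      w u                 ≡⟨ pal-mirror q (solve (u ∷ j ∷ δ ∷ [])) u<end far<end ⟩
      w (x + δ + δ + j)   ∎
      where
      open ≡-Reasoning
      a<end : a < x + δ + R
      a<end = ≤-trans (s≤s (m≤m+n a j)) (≤-trans (≤-reflexive eq) (+-monoʳ-≤ (x + δ) δ≤R))
      x+j<end : x + j < x + δ + R
      x+j<end = <-≤-trans (+-monoʳ-< x (<-≤-trans j<r r≤R)) (+-monoˡ-≤ R (m≤m+n x δ))
      u<end : u < x + δ + R
      u<end = <-≤-trans (m<n+m u z<s) (≤-trans (m≤m+n x δ) (m≤m+n (x + δ) R))
      far<end : x + δ + δ + j < x + δ + R
      far<end = subst (_< x + δ + R) (sym (+-assoc (x + δ) δ j))
                  (+-monoʳ-< (x + δ) (<-≤-trans (+-monoʳ-< δ j<r) δ+r≤R))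

  -- The palindrome at x, cut to radius ry - δ, reflects through x + δ; a longer one at x + δ + δ
  -- would reflect back and extend the palindrome at x + δ.
  maxPal-radius-short : ∀ {x δ rx ry rz} → MaxPal x rx → MaxPal (x + δ) ry → MaxPal (x + δ + δ) rz →
    1 ≤ δ → δ ≤ ry → ry < rx + δ → rz + δ ≡ ry
  maxPal-radius-short {x} {δ} {rx} {ry} {rz} (px , _) (py , stopy) (pz , stopz) 1≤δ δ≤ry ry<rx+δ
    with m≤n⇒∃[o]m+o≡n δ≤ry
  ... | ρ , refl = trans (cong (_+ δ) (≤-antisym (≮⇒≥ too-long) ρ≤rz)) (+-comm ρ δ)
    where
    ρ<rx : ρ < rx
    ρ<rx = +-cancelʳ-< δ ρ rx (subst (_< rx + δ) (+-comm δ ρ) ry<rx+δ)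
    ρ≤rz : ρ ≤ rz
    ρ≤rz = maxPal-maximal (pz , stopz) (pal-reflect py (pal-weaken px (<⇒≤ ρ<rx)) ≤-refl)
    too-long : ¬ ρ < rz
    too-long ρ<rz with m≤n⇒∃[o]m+o≡n (≤-trans ρ<rx (proj₁ px)) | m≤n⇒∃[o]m+o≡n 1≤δ
    ... | u , refl | δ′ , refl = maxPal-edge {a = u} (py , stopy) (solve (u ∷ ρ ∷ δ′ ∷ [])) end<n (begin
      w u                  ≡⟨ pal-at px (cong suc (+-comm u ρ)) ρ<rx ⟩
      w (x + ρ)            ≡⟨ pal-mirror py (solve (u ∷ ρ ∷ δ′ ∷ []))
                                (m+k≡n⇒m≤n (δ′ + δ) (solve (u ∷ ρ ∷ δ′ ∷ [])))
                                (m+k≡n⇒m≤n (ρ + ρ) (solve (u ∷ ρ ∷ δ′ ∷ []))) ⟩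
      w (u + δ + δ)        ≡⟨ pal-at pz (solve (u ∷ ρ ∷ δ′ ∷ [])) ρ<rz ⟩
      w (x + δ + δ + ρ)    ≡⟨ cong w (+-assoc (x + δ) δ ρ) ⟩
      w (x + δ + (δ + ρ))  ∎)
      where
      open ≡-Reasoning
      end<n : x + δ + (δ + ρ) < n
      end<n = ≤-trans (≤-reflexive (trans (cong suc (sym (+-assoc (x + δ) δ ρ))) (sym (+-suc (x + δ + δ) ρ))))
                (≤-trans (+-monoʳ-≤ (x + δ + δ) ρ<rz) (proj₁ (proj₂ pz)))

  -- A longer palindrome at x + δ + δ would reflect through x + δ and extend the palindrome at x.
  maxPal-radius-long : ∀ {x δ rx ry rz} → MaxPal x rx → MaxPal (x + δ) ry → MaxPal (x + δ + δ) rz →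
    δ + rx < ry → rz ≤ rx
  maxPal-radius-long {x} {δ} {rx} {ry} {rz} mx (py , _) (pz , _) δ+rx<ry = ≮⇒≥ too-long
    where
    rx<x : rx < x
    rx<x = +-cancelˡ-< δ rx x (<-≤-trans δ+rx<ry (≤-trans (proj₁ py) (≤-reflexive (+-comm x δ))))
    too-long : ¬ rx < rz
    too-long rx<rz with m≤n⇒∃[o]m+o≡n rx<x | m≤n⇒∃[o]m+o≡n δ+rx<ry
    ... | u , refl | v , refl = maxPal-edge {a = u} mx (solve (u ∷ rx ∷ [])) end<n (begin
      w u                  ≡⟨ pal-mirror py (solve (u ∷ rx ∷ δ ∷ []))
                                (m+k≡n⇒m≤n (suc (rx + rx + δ + δ + v)) (solve (u ∷ rx ∷ δ ∷ v ∷ [])))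
                                (m+k≡n⇒m≤n v (solve (u ∷ rx ∷ δ ∷ v ∷ []))) ⟩
      w (x + δ + δ + rx)   ≡⟨ pal-at pz (solve (u ∷ rx ∷ δ ∷ [])) rx<rz ⟨
      w (u + δ + δ)        ≡⟨ pal-mirror py (solve (u ∷ rx ∷ δ ∷ []))
                                (m+k≡n⇒m≤n (suc (rx + rx + v)) (solve (u ∷ rx ∷ δ ∷ v ∷ []))) x+rx<end ⟩
      w (x + rx)           ∎)
      where
      open ≡-Reasoning
      x+rx<end : x + rx < x + δ + suc (δ + rx + v)
      x+rx<end = m+k≡n⇒m≤n (δ + δ + v) (solve (u ∷ rx ∷ δ ∷ v ∷ []))
      end<n : x + rx < n
      end<n = <-≤-trans x+rx<end (proj₁ (proj₂ py))

  Periodic : ℕ → ℕ → ℕ → Set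
  Periodic p lo hi = ∀ i → lo ≤ i → i + p < hi → w i ≡ w (i + p)

  periodic-restrict : ∀ {p lo hi lo′ hi′} → Periodic p lo hi → lo ≤ lo′ → hi′ ≤ hi → Periodic p lo′ hi′
  periodic-restrict per lo≤lo′ hi′≤hi i lo′≤i i+p<hi′ = per i (≤-trans lo≤lo′ lo′≤i) (<-≤-trans i+p<hi′ hi′≤hi)

  pals-periodic : ∀ {lo c R d} → Pal c R → Pal (c + d) R → lo + R ≡ c → Periodic (d + d) lo (c + d + R)
  pals-periodic {lo} {R = R} {d} p q refl i lo≤i i+2d<end with m≤n⇒∃[o]m+o≡n lo≤i | m≤n⇒∃[o]m+o≡n i+2d<end
  ... | v , refl | k , eq = trans
    (pal-mirror {b = lo + (k + d)} p (≡-by-cancel eq (solve vars))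
      (m+k≡n⇒m≤n (k + d) (≡-by-cancel eq (solve vars))) (m+k≡n⇒m≤n v (≡-by-cancel eq (solve vars))))
    (pal-mirror {a = lo + (k + d)} q (≡-by-cancel eq (solve vars))
      (m+k≡n⇒m≤n (v + d) (≡-by-cancel eq (solve vars))) i+2d<end)
    where vars = lo ∷ v ∷ k ∷ d ∷ R ∷ []

  -- Positions are moved into the window [a, b) by steps of P, where the period Q is known.
  periodic-extend : ∀ {P Q lo hi a b} → 1 ≤ P → Periodic P lo hi → Periodic Q a b →
    lo ≤ a → b ≤ hi → a + P + Q ≤ b → Periodic Q lo hi
  periodic-extend {P} {Q} {lo} {hi} {a} {b} 1≤P perP perQ lo≤a b≤hi window i lo≤i i+Q<hi =
    from-left a i (m≤n+m a i) lo≤i i+Q<hi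
    where
    open ≡-Reasoning

    from-right : ∀ i → a ≤ i → i + Q < hi → w i ≡ w (i + Q)
    from-right = <-rec (λ i → a ≤ i → i + Q < hi → w i ≡ w (i + Q)) step
      where
      step : ∀ i → (∀ {j} → j < i → a ≤ j → j + Q < hi → w j ≡ w (j + Q)) → a ≤ i → i + Q < hi → w i ≡ w (i + Q)
      step i rec a≤i i+Q<hi with i + Q <? b
      ... | yes i+Q<b = perQ i a≤i i+Q<b
      ... | no i+Q≮b with m≤n⇒∃[o]m+o≡n (+-cancelʳ-≤ Q (a + P) i (≤-trans window (≮⇒≥ i+Q≮b)))
      ... | v , refl = begin
        w (a + P + v)       ≡⟨ cong w (+-swapʳ a P v) ⟩
        w (a + v + P)       ≡⟨ perP (a + v) lo≤a+v
                                 (≤-<-trans (m≤m+n (a + v + P) Q) (subst (λ m → m + Q < hi) (+-swapʳ a P v) i+Q<hi)) ⟨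
        w (a + v)           ≡⟨ rec (+-monoˡ-< v (m<m+n a 1≤P)) (m≤m+n a v)
                                 (≤-<-trans (+-monoˡ-≤ Q (+-monoˡ-≤ v (m≤m+n a P))) i+Q<hi) ⟩
        w (a + v + Q)       ≡⟨ perP (a + v + Q) (≤-trans lo≤a+v (m≤m+n (a + v) Q)) (subst (_< hi) shuffle i+Q<hi) ⟩
        w (a + v + Q + P)   ≡⟨ cong w shuffle ⟨
        w (a + P + v + Q)   ∎
        where
        lo≤a+v : lo ≤ a + v
        lo≤a+v = ≤-trans lo≤a (m≤m+n a v)
        shuffle : a + P + v + Q ≡ a + v + Q + P
        shuffle = solve (a ∷ P ∷ v ∷ Q ∷ [])

    from-left : ∀ k i → a ≤ i + k → lo ≤ i → i + Q < hi → w i ≡ w (i + Q)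
    from-left zero i a≤i+0 _ i+Q<hi = from-right i (subst (a ≤_) (+-identityʳ i) a≤i+0) i+Q<hi
    from-left (suc k) i a≤i+1+k lo≤i i+Q<hi with a ≤? i
    ... | yes a≤i = from-right i a≤i i+Q<hi
    ... | no a≰i = begin
      w i           ≡⟨ perP i lo≤i (<-≤-trans (+-monoˡ-< P i<a) (≤-trans (m≤m+n (a + P) Q) b≤hi′)) ⟩
      w (i + P)     ≡⟨ from-left k (i + P) a≤i+P+k (≤-trans lo≤i (m≤m+n i P)) i+P+Q<hi ⟩
      w (i + P + Q) ≡⟨ cong w (+-swapʳ i P Q) ⟩
      w (i + Q + P) ≡⟨ perP (i + Q) (≤-trans lo≤i (m≤m+n i Q)) (subst (_< hi) (+-swapʳ i P Q) i+P+Q<hi) ⟨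
      w (i + Q)     ∎
      where
      i<a : i < a
      i<a = ≰⇒> a≰i
      b≤hi′ : a + P + Q ≤ hi
      b≤hi′ = ≤-trans window b≤hi
      i+P+Q<hi : i + P + Q < hi
      i+P+Q<hi = <-≤-trans (+-monoˡ-< Q (+-monoˡ-< P i<a)) b≤hi′
      a≤i+P+k : a ≤ i + P + k
      a≤i+P+k = ≤-trans a≤i+1+k (≤-trans (≤-reflexive (sym (+-assoc i 1 k))) (+-monoˡ-≤ k (+-monoʳ-≤ i 1≤P)))

  pal-shiftʳ : ∀ {lo hi d R p} → Periodic (d + d) lo hi → Pal p R → d ≤ R → lo + R ≤ p →
    p + d + R ≤ hi → p + d + R ≤ n → Pal (p + d) R
  pal-shiftʳ {lo} {hi} {d} {R} {p} per pp d≤R lo+R≤p end≤hi end≤n =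
    pal-from-mirror (≤-trans (proj₁ pp) (m≤m+n p d)) end≤n mirror
    where
    mirror : ∀ {a j} → suc (a + j) ≡ p + d → j < R → w a ≡ w (p + d + j)
    mirror {a} {j} eq j<R with m≤n⇒∃[o]m+o≡n (≤-trans d≤R (proj₁ pp))
    ... | e , refl = begin
      w a                  ≡⟨ pal-mirror {b = e + j} pp (≡-by-cancel eq (solve (a ∷ j ∷ d ∷ e ∷ []))) a<end e+j<end ⟩
      w (e + j)            ≡⟨ per (e + j) lo≤e+j (subst (_< hi) shift far<hi) ⟩
      w (e + j + (d + d))  ≡⟨ cong w shift ⟨
      w (d + e + d + j)    ∎
      where
      open ≡-Reasoning
      shift : d + e + d + j ≡ e + j + (d + d)
      shift = solve (d ∷ e ∷ j ∷ [])
      a<end : a < d + e + R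
      a<end = ≤-trans (s≤s (m≤m+n a j)) (≤-trans (≤-reflexive eq) (+-monoʳ-≤ (d + e) d≤R))
      e+j<end : e + j < d + e + R
      e+j<end = <-≤-trans (+-monoʳ-< e j<R) (+-monoˡ-≤ R (m≤n+m e d))
      lo≤e+j : lo ≤ e + j
      lo≤e+j = ≤-trans (+-cancelʳ-≤ d lo e (≤-trans (+-monoʳ-≤ lo d≤R) (≤-trans lo+R≤p (≤-reflexive (+-comm d e)))))
                 (m≤m+n e j)
      far<hi : d + e + d + j < hi
      far<hi = <-≤-trans (+-monoʳ-< (d + e + d) j<R) end≤hi

  pal-shiftˡ : ∀ {lo hi d R x} → Periodic (d + d) lo hi → Pal (x + d) R → d ≤ R → lo + R ≤ x →
    x + d + R ≤ hi → Pal x R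
  pal-shiftˡ {lo} {hi} {d} {R} {x} per q d≤R lo+R≤x end≤hi =
    pal-from-mirror (m+n≤o⇒n≤o lo lo+R≤x) (≤-trans (+-monoˡ-≤ R (m≤m+n x d)) (proj₁ (proj₂ q))) mirror
    where
    mirror : ∀ {a j} → suc (a + j) ≡ x → j < R → w a ≡ w (x + j)
    mirror {a} {j} eq j<R = begin
      w a              ≡⟨ per a lo≤a (<-≤-trans a+2d<end end≤hi) ⟩
      w (a + (d + d))  ≡⟨ pal-mirror q (≡-by-cancel eq (solve (a ∷ j ∷ x ∷ d ∷ []))) a+2d<end x+j<end ⟩
      w (x + j)        ∎
      where
      open ≡-Reasoning
      a<x : a < x
      a<x = ≤-trans (s≤s (m≤m+n a j)) (≤-reflexive eq)
      lo≤a : lo ≤ a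
      lo≤a = +-cancelʳ-≤ R lo a (≤-trans lo+R≤x (≤-trans (≤-reflexive (trans (sym eq) (sym (+-suc a j))))
               (+-monoʳ-≤ a j<R)))
      a+2d<end : a + (d + d) < x + d + R
      a+2d<end = ≤-trans (+-monoˡ-≤ (d + d) a<x)
                   (≤-trans (≤-reflexive (sym (+-assoc x d d))) (+-monoʳ-≤ (x + d) d≤R))
      x+j<end : x + j < x + d + R
      x+j<end = <-≤-trans (+-monoʳ-< x j<R) (+-monoˡ-≤ R (m≤m+n x d))

  -- The period of the shorter gap spreads over the window of the longer one (periodic-extend)
  -- and translates the middle palindrome by the shorter gap.
  pal-between-right : ∀ {c d e R} → Pal c R → Pal (c + d) R → Pal (c + d + (d + e)) R →
    1 ≤ e → d + (d + e) ≤ R → Pal (c + d + d) R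
  pal-between-right {c} {d} {e} {R} p₁ p₂ p₃ 1≤e gaps≤R
    with m≤n⇒∃[o]m+o≡n gaps≤R | m≤n⇒∃[o]m+o≡n (proj₁ p₁)
  ... | t , refl | lo , refl =
    pal-shiftʳ per p₂ (m+n≤o⇒m≤o d gaps≤R) (≤-reflexive (solve vars)) end≤ (≤-trans end≤ (proj₁ (proj₂ p₃)))
    where
    vars = lo ∷ d ∷ e ∷ t ∷ []
    1≤2gap : 1 ≤ (d + e) + (d + e)
    1≤2gap = ≤-trans 1≤e (≤-trans (m≤n+m e d) (m≤m+n (d + e) (d + e)))
    window : lo + d + ((d + e) + (d + e)) + (d + d) ≤ c + d + R
    window = m+k≡n⇒m≤n (t + t) (solve vars)
    per₁ : Periodic (d + d) lo (c + d + R)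
    per₁ = pals-periodic p₁ p₂ (+-comm lo R)
    per₂ : Periodic ((d + e) + (d + e)) (lo + d) (c + d + (d + e) + R)
    per₂ = pals-periodic {lo + d} p₂ p₃ (solve vars)
    per : Periodic (d + d) (lo + d) (c + d + (d + e) + R)
    per = periodic-extend 1≤2gap per₂ (periodic-restrict per₁ (m≤m+n lo d) ≤-refl) ≤-refl
            (+-monoˡ-≤ R (m≤m+n (c + d) (d + e))) window
    end≤ : c + d + d + R ≤ c + d + (d + e) + R
    end≤ = m+k≡n⇒m≤n e (solve vars)

  pal-between-left : ∀ {c d e R} → Pal c R → Pal (c + (d + e)) R → Pal (c + (d + e) + d) R →
    1 ≤ e → (d + e) + d ≤ R → Pal (c + e) R
  pal-between-left {c} {d} {e} {R} p₁ p₂ p₃ 1≤e gaps≤R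
    with m≤n⇒∃[o]m+o≡n gaps≤R | m≤n⇒∃[o]m+o≡n (proj₁ p₁)
  ... | t , refl | lo , refl =
    pal-shiftˡ {lo} {d = d} {R} {c + e} per p₂′ (m+n≤o⇒n≤o (d + e) gaps≤R)
      (m+k≡n⇒m≤n e (solve vars)) (≤-reflexive (solve vars))
    where
    vars = lo ∷ d ∷ e ∷ t ∷ []
    1≤2gap : 1 ≤ (d + e) + (d + e)
    1≤2gap = ≤-trans 1≤e (≤-trans (m≤n+m e d) (m≤m+n (d + e) (d + e)))
    window : lo + (d + e) + ((d + e) + (d + e)) + (d + d) ≤ c + (d + e) + R
    window = m+k≡n⇒m≤n (t + t) (solve vars)
    p₂′ : Pal (c + e + d) R
    p₂′ = subst (λ x → Pal x R) (+-swapʳ c d e) (subst (λ x → Pal x R) (sym (+-assoc c d e)) p₂)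
    per₁ : Periodic ((d + e) + (d + e)) lo (c + (d + e) + R)
    per₁ = pals-periodic p₁ p₂ (+-comm lo R)
    per₂ : Periodic (d + d) (lo + (d + e)) (c + (d + e) + d + R)
    per₂ = pals-periodic {lo + (d + e)} p₂ p₃ (solve vars)
    per : Periodic (d + d) lo (c + (d + e) + R)
    per = periodic-extend 1≤2gap per₁
            (periodic-restrict per₂ ≤-refl (+-monoˡ-≤ R (m≤m+n (c + (d + e)) d))) (m≤m+n lo (d + e)) ≤-refl
            window

module Progressions where
  open import Data.List.Relation.Unary.Linked using ([]; [-]; _∷_)

  Ascending : ℕ → List ℕ → Set
  Ascending D = Linked (λ a b → b ≡ a + D)

  Descending : ℕ → List ℕ → Set
  Descending D = Linked (λ a b → b + D ≡ a)

  SplitsIntoAPs : List ℕ → Set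
  SplitsIntoAPs l = Σ (List ℕ) λ xs → Σ (List ℕ) λ ys → Σ (List ℕ) λ zs →
    l ≡ xs ++ ys ++ zs × IsAP xs × length ys ≤ 1 × IsAP zs

  Triplewise : {B : Set} → (B → B → B → Set) → List B → Set
  Triplewise P (a ∷ b ∷ c ∷ t) = P a b c × Triplewise P (b ∷ c ∷ t)
  Triplewise P _ = ⊤

  triplewise-tail : ∀ {B : Set} {P : B → B → B → Set} a t → Triplewise P (a ∷ t) → Triplewise P t
  triplewise-tail a [] _ = tt
  triplewise-tail a (_ ∷ []) _ = tt
  triplewise-tail a (_ ∷ _ ∷ []) _ = tt
  triplewise-tail a (_ ∷ _ ∷ _ ∷ _) (_ , rest) = rest

  -- How the radii a, b, c of maximal palindromes centred at x, x + D, x + D + D constrain each other.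
  RadiusRule : ℕ → ℕ → ℕ → ℕ → Set
  RadiusRule D a b c = (b < a + D → c + D ≡ b) × (a + D < b → c ≤ a)

  descending-after : ∀ {D} → 1 ≤ D → ∀ a b t → Triplewise (RadiusRule D) (a ∷ b ∷ t) → b < a + D →
    Descending D (b ∷ t)
  descending-after 1≤D a b [] _ _ = [-]
  descending-after {D} 1≤D a b (c ∷ t) ((shrinks , _) , rules) b<a+D =
    c+D≡b ∷ descending-after 1≤D b c t rules (≤-<-trans (m+n≤o⇒m≤o c (≤-reflexive c+D≡b)) (m<m+n b 1≤D))
    where
    c+D≡b : c + D ≡ b
    c+D≡b = shrinks b<a+D

  radius-rules⇒split : ∀ {D} → 1 ≤ D → ∀ a t → Triplewise (RadiusRule D) (a ∷ t) →
    Σ (List ℕ) λ xs → Σ (List ℕ) λ ys → Σ (List ℕ) λ zs →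
      t ≡ xs ++ ys ++ zs × Ascending D (a ∷ xs) × length ys ≤ 1 × Descending D zs
  radius-rules⇒split 1≤D a [] _ = [] , [] , [] , refl , [-] , z≤n , []
  radius-rules⇒split {D} 1≤D a (b ∷ t) rules with <-cmp b (a + D)
  ... | tri< b<a+D _ _ = [] , [] , b ∷ t , refl , [-] , z≤n , descending-after 1≤D a b t rules b<a+D
  ... | tri≈ _ b≡a+D _ with radius-rules⇒split 1≤D b t (triplewise-tail a (b ∷ t) rules)
  ...   | xs , ys , zs , t≡ , ascending , |ys|≤1 , descending =
    b ∷ xs , ys , zs , cong (b ∷_) t≡ , b≡a+D ∷ ascending , |ys|≤1 , descending
  radius-rules⇒split {D} 1≤D a (b ∷ []) rules | tri> _ _ a+D<b = [] , b ∷ [] , [] , refl , [-] , s≤s z≤n , []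
  radius-rules⇒split {D} 1≤D a (b ∷ c ∷ t) ((_ , drops) , rules) | tri> _ _ a+D<b =
    [] , b ∷ [] , c ∷ t , refl , [-] , s≤s z≤n ,
    descending-after 1≤D b c t rules (≤-<-trans (drops a+D<b) (<-trans (m<m+n a 1≤D) (<-≤-trans a+D<b (m≤m+n b D))))

  ascending⇒IsAP : ∀ {D xs} → Ascending D xs → IsAP xs
  ascending⇒IsAP {D} ascending = ℤ.+ D , Linked.map (λ { refl → ℤ.pos-+ _ D }) ascending

  descending⇒IsAP : ∀ {D xs} → Descending D xs → IsAP xs
  descending⇒IsAP {D} descending = ℤ.- ℤ.+ D , Linked.map (λ { {_} {b} refl → step b }) descending
    where
    step : ∀ b → ℤ.+ b ≡ ℤ.+ (b + D) ℤ.+ ℤ.- ℤ.+ D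
    step b = trans (add-sub (ℤ.+ b) (ℤ.+ D)) (cong (ℤ._+ ℤ.- ℤ.+ D) (sym (ℤ.pos-+ b D)))
      where
      add-sub : ∀ i j → i ≡ i ℤ.+ j ℤ.+ ℤ.- j
      add-sub = ℤ-Solver.solve-∀

  radius-rules⇒SplitsIntoAPs : ∀ {D} → 1 ≤ D → ∀ a t → Triplewise (RadiusRule D) (a ∷ t) → SplitsIntoAPs (a ∷ t)
  radius-rules⇒SplitsIntoAPs 1≤D a t rules with radius-rules⇒split 1≤D a t rules
  ... | xs , ys , zs , t≡ , ascending , |ys|≤1 , descending =
    a ∷ xs , ys , zs , cong (a ∷_) t≡ , ascending⇒IsAP ascending , |ys|≤1 , descending⇒IsAP descending

  IsAP-double : ∀ {xs} → IsAP xs → IsAP (map (2 *_) xs)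
  IsAP-double (d , steps) = d ℤ.+ d , map⁺ (Linked.map double steps)
    where
    pos-double : ∀ m → ℤ.+ (2 * m) ≡ ℤ.+ m ℤ.+ ℤ.+ m
    pos-double m = trans (cong (λ k → ℤ.+ (m + k)) (+-identityʳ m)) (ℤ.pos-+ m m)
    double : ∀ {x y} → ℤ.+ y ≡ ℤ.+ x ℤ.+ d → ℤ.+ (2 * y) ≡ ℤ.+ (2 * x) ℤ.+ (d ℤ.+ d)
    double {x} {y} step = begin
      ℤ.+ (2 * y)                            ≡⟨ pos-double y ⟩
      ℤ.+ y ℤ.+ ℤ.+ y                        ≡⟨ cong₂ ℤ._+_ step step ⟩
      (ℤ.+ x ℤ.+ d) ℤ.+ (ℤ.+ x ℤ.+ d)        ≡⟨ interchange (ℤ.+ x) d ⟩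
      (ℤ.+ x ℤ.+ ℤ.+ x) ℤ.+ (d ℤ.+ d)        ≡⟨ cong (ℤ._+ (d ℤ.+ d)) (pos-double x) ⟨
      ℤ.+ (2 * x) ℤ.+ (d ℤ.+ d)              ∎
      where
      open ≡-Reasoning
      interchange : ∀ i j → (i ℤ.+ j) ℤ.+ (i ℤ.+ j) ≡ (i ℤ.+ i) ℤ.+ (j ℤ.+ j)
      interchange = ℤ-Solver.solve-∀

  SplitsIntoAPs-double : ∀ {l} → SplitsIntoAPs l → SplitsIntoAPs (map (2 *_) l)
  SplitsIntoAPs-double (xs , ys , zs , refl , xs-AP , |ys|≤1 , zs-AP) =
    map (2 *_) xs , map (2 *_) ys , map (2 *_) zs ,
    trans (map-++ (2 *_) xs (ys ++ zs)) (cong (map (2 *_) xs ++_) (map-++ (2 *_) ys zs)) ,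
    IsAP-double xs-AP , subst (_≤ 1) (sym (length-map (2 *_) ys)) |ys|≤1 , IsAP-double zs-AP

inBlock-width : ∀ {τ k c c′} → InBlock τ k c → InBlock τ k c′ → c′ < c + τ
inBlock-width {k = zero} _ (_ , ())
inBlock-width {τ} {suc k} {c} (kτ≤c , _) (_ , c′<[k+1]τ) =
  <-≤-trans c′<[k+1]τ (subst (_≤ c + τ) (+-comm (k * τ) τ) (+-monoˡ-≤ τ kτ≤c))

inBlock-span : ∀ {τ k c s} → InBlock τ k c → InBlock τ k (c + s) → s < τ
inBlock-span {τ} {k} {c} {s} c∈B c+s∈B = +-cancelˡ-< c s τ (inBlock-width {τ} {k} c∈B c+s∈B)

inBlock-convex : ∀ {τ k a b x} → InBlock τ k a → InBlock τ k b → a ≤ x → x ≤ b → InBlock τ k x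
inBlock-convex (lo≤a , _) (_ , b<hi) a≤x x≤b = ≤-trans lo≤a a≤x , ≤-<-trans x≤b b<hi

module Block {A : Set} (n : ℕ) (w : ℕ → A) (τ k : ℕ) (L : List (ℕ × ℕ))
  (sound : ∀ c r → (c , r) ∈ L → IsMaxEvenPal n w c r × InBlock τ k c × 2 * τ < 2 * r)
  (complete : ∀ c r → c < n → IsMaxEvenPal n w c r → InBlock τ k c → 2 * τ < 2 * r → (c , r) ∈ L) where
  open Palindromes n w
  open Progressions
  open import Data.List.Relation.Unary.Linked using ([]; [-]; _∷_)
  open import Data.List.Relation.Unary.All using (All; []; _∷_)

  LongInBlock : ℕ × ℕ → Set
  LongInBlock (c , r) = MaxPal c r × InBlock τ k c × τ < r

  member-long : ∀ {z} → z ∈ L → LongInBlock z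
  member-long {c , r} z∈L with sound c r z∈L
  ... | max , c∈B , 2τ<2r = max , c∈B , *-cancelˡ-< 2 τ r 2τ<2r

  longInBlock⇒pal : ∀ {c r} → LongInBlock (c , r) → Pal c (suc τ)
  longInBlock⇒pal ((p , _) , _ , τ<r) = pal-weaken p τ<r

  NoCenterBetween : ℕ → ℕ → Set
  NoCenterBetween a b = ∀ {c r} → (c , r) ∈ L → a < c → c < b → ⊥

  no-long-pal-between : ∀ {a b x} → NoCenterBetween a b → InBlock τ k a → InBlock τ k b → a < x → x < b →
    ¬ Pal x (suc τ)
  no-long-pal-between gap a∈B b∈B a<x x<b p = pal-¬¬max p λ (r , τ<r , max) →
    gap (complete _ r (<-≤-trans (m<m+n _ z<s) (proj₁ (proj₂ p))) max
           (inBlock-convex {τ} {k} a∈B b∈B (<⇒≤ a<x) (<⇒≤ x<b)) (*-monoʳ-< 2 τ<r))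
        a<x x<b

  inBlock : ∀ {c r} → LongInBlock (c , r) → InBlock τ k c
  inBlock (_ , c∈B , _) = c∈B

  span≤1+τ : ∀ {c r s} → LongInBlock (c , r) → InBlock τ k (c + s) → s ≤ suc τ
  span≤1+τ (_ , c∈B , _) c+s∈B = ≤-trans (<⇒≤ (inBlock-span {τ} {k} c∈B c+s∈B)) (n≤1+n τ)

  second-gap-not-longer : ∀ {c d₁ d₂ r₁ r₂ r₃} →
    LongInBlock (c , r₁) → LongInBlock (c + d₁ , r₂) → LongInBlock (c + d₁ + d₂ , r₃) →
    NoCenterBetween (c + d₁) (c + d₁ + d₂) → 1 ≤ d₁ → ¬ d₁ < d₂
  second-gap-not-longer {c} {d₁} l₁ l₂ l₃ gap 1≤d₁ d₁<d₂ with <⇒positive-offset d₁<d₂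
  ... | e , 1≤e , refl =
    no-long-pal-between gap (inBlock l₂) (inBlock l₃) (m<m+n (c + d₁) 1≤d₁) (+-monoʳ-< (c + d₁) (m<m+n d₁ 1≤e))
      (pal-between-right (longInBlock⇒pal l₁) (longInBlock⇒pal l₂) (longInBlock⇒pal l₃) 1≤e
        (span≤1+τ l₁ (subst (InBlock τ k) (+-assoc c d₁ (d₁ + e)) (inBlock l₃))))

  first-gap-not-longer : ∀ {c d₁ d₂ r₁ r₂ r₃} →
    LongInBlock (c , r₁) → LongInBlock (c + d₁ , r₂) → LongInBlock (c + d₁ + d₂ , r₃) →
    NoCenterBetween c (c + d₁) → 1 ≤ d₂ → ¬ d₂ < d₁
  first-gap-not-longer {c} {d₂ = d₂} l₁ l₂ l₃ gap 1≤d₂ d₂<d₁ with <⇒positive-offset d₂<d₁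
  ... | e , 1≤e , refl =
    no-long-pal-between gap (inBlock l₁) (inBlock l₂) (m<m+n c 1≤e) (+-monoʳ-< c (m<n+m e 1≤d₂))
      (pal-between-left (longInBlock⇒pal l₁) (longInBlock⇒pal l₂) (longInBlock⇒pal l₃) 1≤e
        (span≤1+τ l₁ (subst (InBlock τ k) (+-assoc c (d₂ + e) d₂) (inBlock l₃))))

  gaps-equal : ∀ {c d₁ d₂ r₁ r₂ r₃} →
    LongInBlock (c , r₁) → LongInBlock (c + d₁ , r₂) → LongInBlock (c + d₁ + d₂ , r₃) →
    NoCenterBetween c (c + d₁) → NoCenterBetween (c + d₁) (c + d₁ + d₂) → 1 ≤ d₁ → 1 ≤ d₂ → d₁ ≡ d₂
  gaps-equal l₁ l₂ l₃ gap₁ gap₂ 1≤d₁ 1≤d₂ =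
    ≤-antisym (≮⇒≥ (first-gap-not-longer l₁ l₂ l₃ gap₁ 1≤d₂)) (≮⇒≥ (second-gap-not-longer l₁ l₂ l₃ gap₂ 1≤d₁))

  _<ᶜ_ : ℕ × ℕ → ℕ × ℕ → Set
  p <ᶜ q = proj₁ p < proj₁ q

  EndSegment : ℕ × ℕ → List (ℕ × ℕ) → Set
  EndSegment p t = ∀ {z} → z ∈ L → z ∈ p ∷ t ⊎ z <ᶜ p

  end-segment-tail : ∀ {p q t} → EndSegment p (q ∷ t) → p <ᶜ q → EndSegment q t
  end-segment-tail seg p<q z∈L with seg z∈L
  ... | inj₁ (here refl) = inj₂ p<q
  ... | inj₁ (there z∈q∷t) = inj₁ z∈q∷t
  ... | inj₂ z<p = inj₂ (<-trans z<p p<q)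

  sorted-after : ∀ {q t z} → Linked _<ᶜ_ (q ∷ t) → z ∈ t → q <ᶜ z
  sorted-after (q<x ∷ _) (here refl) = q<x
  sorted-after (q<x ∷ sorted) (there z∈t) = <-trans q<x (sorted-after sorted z∈t)

  end-segment-gap : ∀ {p q t} → EndSegment p (q ∷ t) → Linked _<ᶜ_ (p ∷ q ∷ t) →
    NoCenterBetween (proj₁ p) (proj₁ q)
  end-segment-gap seg (_ ∷ sorted) z∈L p<z z<q with seg z∈L
  ... | inj₁ (here refl) = <-irrefl refl p<z
  ... | inj₁ (there (here refl)) = <-irrefl refl z<q
  ... | inj₁ (there (there z∈t)) = <-asym z<q (sorted-after sorted z∈t)
  ... | inj₂ z<p = <-asym z<p p<z

  Spaced : ℕ → List (ℕ × ℕ) → Set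
  Spaced D = Linked (λ p q → proj₁ q ≡ proj₁ p + D)

  centers-spaced : ∀ {D p q t} → EndSegment p (q ∷ t) → Linked _<ᶜ_ (p ∷ q ∷ t) →
    All LongInBlock (p ∷ q ∷ t) → 1 ≤ D → proj₁ q ≡ proj₁ p + D → Spaced D (p ∷ q ∷ t)
  centers-spaced {t = []} _ _ _ _ q≡p+D = q≡p+D ∷ [-]
  centers-spaced {D} {c , _} {c₂ , _} {(c₃ , _) ∷ t} seg sorted@(p<q ∷ q<r ∷ rest) (l₁ ∷ l₂ ∷ l₃ ∷ longs) 1≤D refl
    with <⇒positive-offset q<r
  ... | d , 1≤d , refl =
    refl ∷ centers-spaced seg′ (q<r ∷ rest) (l₂ ∷ l₃ ∷ longs) 1≤D (cong (c + D +_) (sym D≡d))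
    where
    seg′ = end-segment-tail seg p<q
    D≡d : D ≡ d
    D≡d = gaps-equal l₁ l₂ l₃ (end-segment-gap seg sorted) (end-segment-gap seg′ (q<r ∷ rest)) 1≤D 1≤d

  radius-rule : ∀ {D c₁ c₂ c₃ r₁ r₂ r₃} →
    LongInBlock (c₁ , r₁) → LongInBlock (c₂ , r₂) → LongInBlock (c₃ , r₃) →
    c₂ ≡ c₁ + D → c₃ ≡ c₂ + D → 1 ≤ D → RadiusRule D r₁ r₂ r₃
  radius-rule {D} {r₁ = r₁} {r₂} (m₁ , b₁ , _) (m₂ , b₂ , τ<r₂) (m₃ , _) refl refl 1≤D =
    maxPal-radius-short m₁ m₂ m₃ 1≤D (≤-trans (<⇒≤ (inBlock-span {τ} {k} b₁ b₂)) (<⇒≤ τ<r₂)) ,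
    λ r₁+D<r₂ → maxPal-radius-long m₁ m₂ m₃ (subst (_< r₂) (+-comm r₁ D) r₁+D<r₂)

  radius-rules : ∀ {D t} → 1 ≤ D → All LongInBlock t → Spaced D t → Triplewise (RadiusRule D) (map proj₂ t)
  radius-rules _ [] _ = tt
  radius-rules _ (_ ∷ []) _ = tt
  radius-rules _ (_ ∷ _ ∷ []) _ = tt
  radius-rules 1≤D (l₁ ∷ l₂ ∷ l₃ ∷ longs) (e₁ ∷ e₂ ∷ spaced) =
    radius-rule l₁ l₂ l₃ e₁ e₂ 1≤D , radius-rules 1≤D (l₂ ∷ l₃ ∷ longs) (e₂ ∷ spaced)

open Progressions using (SplitsIntoAPs; SplitsIntoAPs-double; radius-rules⇒SplitsIntoAPs; ascending⇒IsAP)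

lemma3 : {A : Set} (n : ℕ) (w : ℕ → A) (τ : ℕ) →
    1 ≤ τ → 4 * τ ≤ n → (2 * τ) ∣ n →
    (k : ℕ) → 1 ≤ k → k * τ ≤ n →
    (L : List (ℕ × ℕ)) →
    Linked (λ p q → proj₁ p < proj₁ q) L →
    (∀ c r → (c , r) ∈ L → IsMaxEvenPal n w c r × InBlock τ k c × 2 * τ < 2 * r) →
    (∀ c r → c < n → IsMaxEvenPal n w c r → InBlock τ k c → 2 * τ < 2 * r → (c , r) ∈ L) →
    3 ≤ length L →
    (Σ (List ℕ) λ xs → Σ (List ℕ) λ ys → Σ (List ℕ) λ zs →
       map (λ p → 2 * proj₂ p) L ≡ xs ++ ys ++ zs
       × IsAP xs × length ys ≤ 1 × IsAP zs)
    × IsAP (map proj₁ L)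
lemma3 n w τ _ _ _ k _ _ L@(_ ∷ _ ∷ _) sorted sound complete _ with <⇒positive-offset (Linked.head sorted)
... | D , 1≤D , p+D≡q = subst SplitsIntoAPs (sym (map-∘ L)) (SplitsIntoAPs-double radii) , ascending⇒IsAP (map⁺ spaced)
  where
  open Block n w τ k L sound complete
  longs : All LongInBlock L
  longs = tabulate member-long
  spaced : Spaced D L
  spaced = centers-spaced (λ z∈L → inj₁ z∈L) sorted longs 1≤D (sym p+D≡q)
  radii : SplitsIntoAPs (map proj₂ L)
  radii = radius-rules⇒SplitsIntoAPs 1≤D _ _ (radius-rules 1≤D longs spaced)
lemma3 _ _ _ _ _ _ _ _ _ [] _ _ _ ()
lemma3 _ _ _ _ _ _ _ _ _ (_ ∷ []) _ _ _ (s≤s ())
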